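{- Let $R$ be a finite commutative principal ideal ring with unity. Suppose the set $\mathrm{Ass}(R)$ of associated primes of $R$ has exactly two elements $p_1,p_2$, and $p_1\cap p_2=\{0\}$. Then the complement $\overline{\Gamma(R)}$ of the zero divisor graph is a divisor graph.
   Context: $\mathrm{Ass}(R)$ is the set of associated primes of $R$ as an $R$-module, i.e., prime ideals $P$ of $R$ with $P=\mathrm{ann}(x)$ for some nonzero $x\in R$. The zero divisor graph $\Gamma(R)$ has vertex set the nonzero zero divisors of $R$, distinct $a,b$ adjacent iff $ab=0$; its complement $\overline{\Gamma(R)}$ has the same vertex set, distinct $a,b$ adjacent iff $ab\neq 0$. A graph $G$ is a divisor graph if it is isomorphic to the graph $G(S)$ on some set $S$ of positive integers in which distinct $i,j$ are adjacent iff $i\mid j$ or $j\mid i$. -}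

module Defs where

open import Level using (Level; _⊔_)
open import Algebra.Bundles using (CommutativeRing)
open import Data.Nat using (ℕ; _>_)
open import Data.Nat.Divisibility using (_∣_)
open import Data.Fin using (Fin)
open import Data.Product using (Σ; ∃; _×_; _,_)
open import Data.Sum using (_⊎_)
open import Relation.Nullary using (¬_)
open import Relation.Binary.PropositionalEquality using (_≡_)

module _ {c ℓ : Level} (R : CommutativeRing c ℓ) where
  open CommutativeRing R

  _⇔'_ : ∀ {a b} → Set a → Set b → Set (a ⊔ b)
  A ⇔' B = (A → B) × (B → A)

  Subset : Set (Level.suc (c ⊔ ℓ))
  Subset = Carrier → Set (c ⊔ ℓ)

  _≐_ : Subset → Subset → Set (c ⊔ ℓ)
  P ≐ Q = ∀ x → P x ⇔' Q x

  IsFinite : Set (c ⊔ ℓ)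
  IsFinite = Σ ℕ λ n → Σ (Fin n → Carrier) λ e →
               (∀ x → Σ (Fin n) λ i → e i ≈ x)
             × (∀ i j → e i ≈ e j → i ≡ j)

  record IsIdeal (I : Subset) : Set (c ⊔ ℓ) where
    field
      resp  : ∀ {x y} → x ≈ y → I x → I y
      has0  : I 0#
      +-cl  : ∀ {x y} → I x → I y → I (x + y)
      -‿cl  : ∀ {x} → I x → I (- x)
      *-cl  : ∀ r {x} → I x → I (r * x)

  ⟨_⟩ : Carrier → Subset
  ⟨ a ⟩ x = Σ Carrier λ r → x ≈ r * a

  IsPrincipalIdealRing : Set (Level.suc (c ⊔ ℓ))
  IsPrincipalIdealRing = ∀ (I : Subset) → IsIdeal I → Σ Carrier λ a → I ≐ ⟨ a ⟩

  record IsPrimeIdeal (P : Subset) : Set (c ⊔ ℓ) where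
    field
      ideal  : IsIdeal P
      proper : ¬ P 1#
      prime  : ∀ a b → P (a * b) → P a ⊎ P b

  ann : Carrier → Subset
  ann x y = Level.Lift (c ⊔ ℓ) (y * x ≈ 0#)

  IsAssociatedPrime : Subset → Set (c ⊔ ℓ)
  IsAssociatedPrime P = IsPrimeIdeal P × Σ Carrier λ x → (¬ x ≈ 0#) × P ≐ ann x

  _∩_ : Subset → Subset → Subset
  (P ∩ Q) x = P x × Q x

  AssIsTwoPrimesMeetingInZero : Set (Level.suc (c ⊔ ℓ))
  AssIsTwoPrimesMeetingInZero =
    Σ Subset λ p₁ → Σ Subset λ p₂ →
        IsAssociatedPrime p₁
      × IsAssociatedPrime p₂
      × ¬ (p₁ ≐ p₂)
      × (∀ P → IsAssociatedPrime P → (P ≐ p₁) ⊎ (P ≐ p₂))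
      × (∀ x → (p₁ ∩ p₂) x → x ≈ 0#)

  IsVertex : Carrier → Set (c ⊔ ℓ)
  IsVertex a = (¬ a ≈ 0#) × Σ Carrier λ b → (¬ b ≈ 0#) × (a * b ≈ 0#)

  -- adjacency in the complement of Γ(R) (for distinct vertices)
  ComplAdj : Carrier → Carrier → Set ℓ
  ComplAdj a b = ¬ (a * b ≈ 0#)

  -- Then f is a graph isomorphism onto G(S)
  -- with S = f(V(Γ(R))) (a finite set of positive integers).
  ComplementIsDivisorGraph : Set (c ⊔ ℓ)
  ComplementIsDivisorGraph =
    Σ (Carrier → ℕ) λ f →
        (∀ a → IsVertex a → f a > 0)
      × (∀ a b → IsVertex a → IsVertex b → a ≈ b → f a ≡ f b)
      × (∀ a b → IsVertex a → IsVertex b → f a ≡ f b → a ≈ b)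
      × (∀ a b → IsVertex a → IsVertex b → ¬ a ≈ b →
           ComplAdj a b ⇔' (f a ∣ f b ⊎ f b ∣ f a))

-- The two associated primes cover all zero divisors: if ab = 0 with a, b ≠ 0 and a ∉ p₁, then b ∈ p₁
-- (p₁ is prime), so b ∉ p₂ (as p₁ ∩ p₂ = 0), forcing a ∈ p₂. Two nonzero elements of the same pᵢ
-- have nonzero product, since otherwise one of them lies in the other prime and hence in
-- p₁ ∩ p₂ = 0, while p₁p₂ ⊆ p₁ ∩ p₂ = 0. So the complement of Γ(R) is a disjoint union of two
-- cliques, and such a graph is a divisor graph: number the vertices and send the k-th vertex of
-- the first clique to 2^(k+1) and of the second to 3^(k+1).
module Submission where

open import Defs
open import Level using (Level; _⊔_; lift; lower)
open import Algebra.Bundles using (CommutativeRing)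
open import Data.Bool using (Bool; true; false)
open import Data.Empty using (⊥-elim)
open import Function using (_∘_)
open import Data.Fin using (Fin; toℕ)
open import Data.Fin.Properties using (toℕ-injective)
open import Data.Nat using (ℕ; suc; _^_; _≤_; _<_; _>_; s≤s; z≤n; nonTrivial⇒≢1)
open import Data.Nat.Divisibility using (_∣_; _∤_; divides; ∣-trans; ∣-reflexive; m∣m*n; ∣1⇒≡1)
open import Data.Nat.Primality using (Prime; euclidsLemma; prime?; prime[2]; prime⇒nonTrivial; prime⇒irreducible)
open import Data.Nat.Properties using (<-cmp; ≤-total; ^-distribˡ-+-*; m^n>0; ^-monoʳ-<; m≤n⇒∃[o]m+o≡n; <-irrefl; suc-injective)
import Data.Nat.Properties as ℕ
open import Data.Product using (_×_; _,_; proj₁; proj₂)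
open import Data.Sum using (_⊎_; inj₁; inj₂; [_,_])
open import Data.Unit using (tt)
open import Relation.Binary using (tri<; tri≈; tri>)
open import Relation.Binary.PropositionalEquality as ≡ using (_≡_; _≢_; refl)
open import Relation.Nullary using (¬_; Dec; yes; no; does)
open import Relation.Nullary.Decidable using (toWitness; map′)

^-monoʳ-∣ : ∀ m {i j} → i ≤ j → m ^ i ∣ m ^ j
^-monoʳ-∣ m {i} i≤j with m≤n⇒∃[o]m+o≡n i≤j
... | k , refl = divides (m ^ k) (≡.trans (^-distribˡ-+-* m i k) (ℕ.*-comm (m ^ i) (m ^ k)))

^-comparable : ∀ m i j → m ^ i ∣ m ^ j ⊎ m ^ j ∣ m ^ i
^-comparable m i j with ≤-total i j
... | inj₁ i≤j = inj₁ (^-monoʳ-∣ m i≤j)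
... | inj₂ j≤i = inj₂ (^-monoʳ-∣ m j≤i)

^-injectiveʳ : ∀ m → 1 < m → ∀ {i j} → m ^ i ≡ m ^ j → i ≡ j
^-injectiveʳ m 1<m {i} {j} eq with <-cmp i j
... | tri< i<j _ _ = ⊥-elim (<-irrefl eq (^-monoʳ-< m 1<m i<j))
... | tri≈ _ i≡j _ = i≡j
... | tri> _ _ j<i = ⊥-elim (<-irrefl (≡.sym eq) (^-monoʳ-< m 1<m j<i))

prime∤prime^ : ∀ {p q} → Prime p → Prime q → p ≢ q → ∀ m → p ∤ q ^ m
prime∤prime^ pp _ _ 0 p∣1 = nonTrivial⇒≢1 ⦃ prime⇒nonTrivial pp ⦄ (∣1⇒≡1 p∣1)
prime∤prime^ {p} {q} pp pq p≢q (suc m) p∣q^1+m with euclidsLemma q (q ^ m) pp p∣q^1+m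
... | inj₁ p∣q = [ nonTrivial⇒≢1 ⦃ prime⇒nonTrivial pp ⦄ , p≢q ] (prime⇒irreducible pq p∣q)
... | inj₂ p∣q^m = prime∤prime^ pp pq p≢q m p∣q^m

prime^suc∤prime^ : ∀ {p q} → Prime p → Prime q → p ≢ q → ∀ i j → p ^ suc i ∤ q ^ j
prime^suc∤prime^ {p} pp pq p≢q i j d = prime∤prime^ pp pq p≢q j (∣-trans (m∣m*n (p ^ i)) d)

code : Bool → ℕ → ℕ
code true  i = 2 ^ suc i
code false i = 3 ^ suc i

code>0 : ∀ s i → code s i > 0
code>0 true  i = m^n>0 2 (suc i)
code>0 false i = m^n>0 3 (suc i)

prime[3] : Prime 3
prime[3] = toWitness {a? = prime? 3} tt

code-true∤code-false : ∀ i j → code true i ∤ code false j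
code-true∤code-false i j = prime^suc∤prime^ prime[2] prime[3] (λ ()) i (suc j)

code-false∤code-true : ∀ i j → code false i ∤ code true j
code-false∤code-true i j = prime^suc∤prime^ prime[3] prime[2] (λ ()) i (suc j)

code-comparable⇒≡ : ∀ s t i j → code s i ∣ code t j ⊎ code t j ∣ code s i → s ≡ t
code-comparable⇒≡ true  true  i j _ = refl
code-comparable⇒≡ false false i j _ = refl
code-comparable⇒≡ true  false i j c = ⊥-elim ([ code-true∤code-false i j , code-false∤code-true j i ] c)
code-comparable⇒≡ false true  i j c = ⊥-elim ([ code-false∤code-true i j , code-true∤code-false j i ] c)

≡⇒code-comparable : ∀ s t i j → s ≡ t → code s i ∣ code t j ⊎ code t j ∣ code s i
≡⇒code-comparable true  _ i j refl = ^-comparable 2 (suc i) (suc j)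
≡⇒code-comparable false _ i j refl = ^-comparable 3 (suc i) (suc j)

code-injective : ∀ s t i j → code s i ≡ code t j → s ≡ t × i ≡ j
code-injective s t i j eq with code-comparable⇒≡ s t i j (inj₁ (∣-reflexive eq))
code-injective true  _ i j eq | refl = refl , suc-injective (^-injectiveʳ 2 (s≤s (s≤s z≤n)) eq)
code-injective false _ i j eq | refl = refl , suc-injective (^-injectiveʳ 3 (s≤s (s≤s z≤n)) eq)

module _ {c ℓ : Level} (R : CommutativeRing c ℓ) where
  open CommutativeRing R hiding (refl)

  record Numbering : Set (c ⊔ ℓ) where
    field
      number           : Carrier → ℕ
      number-cong      : ∀ {a b} → a ≈ b → number a ≡ number b
      number-injective : ∀ {a b} → number a ≡ number b → a ≈ b

    _≈?_ : ∀ a b → Dec (a ≈ b)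
    a ≈? b = map′ number-injective number-cong (number a ℕ.≟ number b)

  finite⇒numbering : IsFinite R → Numbering
  finite⇒numbering (_ , enum , onto , enum-injective) =
    record { number = toℕ ∘ index ; number-cong = index-cong ; number-injective = index-injective ∘ toℕ-injective }
    where
    index : Carrier → Fin _
    index a = proj₁ (onto a)

    enum∘index : ∀ a → enum (index a) ≈ a
    enum∘index a = proj₂ (onto a)

    index-cong : ∀ {a b} → a ≈ b → toℕ (index a) ≡ toℕ (index b)
    index-cong {a} {b} a≈b = ≡.cong toℕ (enum-injective _ _ (trans (enum∘index a) (trans a≈b (sym (enum∘index b)))))

    index-injective : ∀ {a b} → index a ≡ index b → a ≈ b
    index-injective {a} {b} eq = trans (sym (enum∘index a)) (trans (reflexive (≡.cong enum eq)) (enum∘index b))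

  ann-decidable : Numbering → ∀ {P : Subset R} {x} → _≐_ R P (ann R x) → ∀ a → Dec (P a)
  ann-decidable ν P≐ann a =
    map′ (λ ax≈0 → proj₂ (P≐ann a) (lift ax≈0)) (λ a∈P → lower (proj₁ (P≐ann a) a∈P)) ((a * _) ≈? 0#)
    where open Numbering ν

  twoCliques⇒divisorGraph : Numbering → (colour : Carrier → Bool) →
    (∀ {a b} → a ≈ b → colour a ≡ colour b) →
    (∀ {a b} → IsVertex R a → IsVertex R b → _⇔'_ R (ComplAdj R a b) (colour a ≡ colour b)) →
    ComplementIsDivisorGraph R
  twoCliques⇒divisorGraph ν colour colour-cong adjacent⇔sameColour =
    f , positive , (λ _ _ _ _ → f-cong) , (λ _ _ _ _ → f-injective) , adjacent⇔comparable
    where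
    open Numbering ν
    f : Carrier → ℕ
    f a = code (colour a) (number a)

    positive : ∀ a → IsVertex R a → f a > 0
    positive a _ = code>0 (colour a) (number a)

    f-cong : ∀ {a b} → a ≈ b → f a ≡ f b
    f-cong a≈b = ≡.cong₂ code (colour-cong a≈b) (number-cong a≈b)

    f-injective : ∀ {a b} → f a ≡ f b → a ≈ b
    f-injective {a} {b} eq = number-injective (proj₂ (code-injective (colour a) (colour b) (number a) (number b) eq))

    adjacent⇔comparable : ∀ a b → IsVertex R a → IsVertex R b → ¬ a ≈ b →
      _⇔'_ R (ComplAdj R a b) (f a ∣ f b ⊎ f b ∣ f a)
    adjacent⇔comparable a b va vb _ =
        (λ adj → ≡⇒code-comparable (colour a) (colour b) (number a) (number b) (proj₁ (adjacent⇔sameColour va vb) adj))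
      , (λ cmp → proj₂ (adjacent⇔sameColour va vb) (code-comparable⇒≡ (colour a) (colour b) (number a) (number b) cmp))

  MeetInZero : Subset R → Subset R → Set (c ⊔ ℓ)
  MeetInZero P Q = ∀ x → _∩_ R P Q x → x ≈ 0#

  meetInZero-sym : ∀ {P Q} → MeetInZero P Q → MeetInZero Q P
  meetInZero-sym P∩Q≈0 x (Qx , Px) = P∩Q≈0 x (Px , Qx)

  ≈0⇒∈ideal : ∀ {I} → IsIdeal R I → ∀ {x} → x ≈ 0# → I x
  ≈0⇒∈ideal I x≈0 = IsIdeal.resp I (sym x≈0) (IsIdeal.has0 I)

  open IsPrimeIdeal

  module MeetingPrimes {P Q : Subset R} (P-prime : IsPrimeIdeal R P) (Q-prime : IsPrimeIdeal R Q)
                       (P∩Q≈0 : MeetInZero P Q) where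

    vertex∉P⇒∈Q : ∀ {a} → IsVertex R a → ¬ P a → Q a
    vertex∉P⇒∈Q {a} (_ , b , b≉0 , ab≈0) a∉P
      with prime P-prime a b (≈0⇒∈ideal (ideal P-prime) ab≈0) | prime Q-prime a b (≈0⇒∈ideal (ideal Q-prime) ab≈0)
    ... | inj₁ a∈P | _        = ⊥-elim (a∉P a∈P)
    ... | inj₂ _   | inj₁ a∈Q = a∈Q
    ... | inj₂ b∈P | inj₂ b∈Q = ⊥-elim (b≉0 (P∩Q≈0 b (b∈P , b∈Q)))

    *-≉0-inP : ∀ {a b} → P a → P b → ¬ a ≈ 0# → ¬ b ≈ 0# → ¬ a * b ≈ 0#
    *-≉0-inP {a} {b} a∈P b∈P a≉0 b≉0 ab≈0 with prime Q-prime a b (≈0⇒∈ideal (ideal Q-prime) ab≈0)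
    ... | inj₁ a∈Q = a≉0 (P∩Q≈0 a (a∈P , a∈Q))
    ... | inj₂ b∈Q = b≉0 (P∩Q≈0 b (b∈P , b∈Q))

    *-≈0-across : ∀ {a b} → P a → Q b → a * b ≈ 0#
    *-≈0-across {a} {b} a∈P b∈Q = P∩Q≈0 (a * b)
      (IsIdeal.resp (ideal P-prime) (*-comm b a) (IsIdeal.*-cl (ideal P-prime) b a∈P) , IsIdeal.*-cl (ideal Q-prime) a b∈Q)

  module Membership {P Q : Subset R} (P-prime : IsPrimeIdeal R P) (Q-prime : IsPrimeIdeal R Q)
                    (P∩Q≈0 : MeetInZero P Q) (P? : ∀ a → Dec (P a)) where
    open MeetingPrimes P-prime Q-prime P∩Q≈0
    open MeetingPrimes Q-prime P-prime (meetInZero-sym P∩Q≈0) using () renaming (*-≉0-inP to *-≉0-inQ)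

    inP : Carrier → Bool
    inP a = does (P? a)

    inP-cong : ∀ {a b} → a ≈ b → inP a ≡ inP b
    inP-cong {a} {b} a≈b with P? a | P? b
    ... | yes _   | yes _   = refl
    ... | no  _   | no  _   = refl
    ... | yes a∈P | no  b∉P = ⊥-elim (b∉P (IsIdeal.resp (ideal P-prime) a≈b a∈P))
    ... | no  a∉P | yes b∈P = ⊥-elim (a∉P (IsIdeal.resp (ideal P-prime) (sym a≈b) b∈P))

    complAdj⇔sameInP : ∀ {a b} → IsVertex R a → IsVertex R b → _⇔'_ R (ComplAdj R a b) (inP a ≡ inP b)
    complAdj⇔sameInP {a} {b} va@(a≉0 , _) vb@(b≉0 , _) with P? a | P? b
    ... | yes a∈P | yes b∈P = (λ _ → refl) , λ _ → *-≉0-inP a∈P b∈P a≉0 b≉0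
    ... | no  a∉P | no  b∉P = (λ _ → refl) , λ _ → *-≉0-inQ (vertex∉P⇒∈Q va a∉P) (vertex∉P⇒∈Q vb b∉P) a≉0 b≉0
    ... | yes a∈P | no  b∉P = (λ adj → ⊥-elim (adj (*-≈0-across a∈P (vertex∉P⇒∈Q vb b∉P)))) , λ ()
    ... | no  a∉P | yes b∈P = (λ adj → ⊥-elim (adj (trans (*-comm a b) (*-≈0-across b∈P (vertex∉P⇒∈Q va a∉P))))) , λ ()

theorem2p8 : ∀ {c ℓ : Level} (R : CommutativeRing c ℓ) →
    IsFinite R → IsPrincipalIdealRing R → AssIsTwoPrimesMeetingInZero R →
    ComplementIsDivisorGraph R
theorem2p8 R finite _ (_ , _ , (p₁-prime , _ , _ , p₁≐ann) , (p₂-prime , _) , _ , _ , p₁∩p₂≈0) =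
  twoCliques⇒divisorGraph R ν inP inP-cong complAdj⇔sameInP
  where
  ν : Numbering R
  ν = finite⇒numbering R finite
  open Membership R p₁-prime p₂-prime p₁∩p₂≈0 (ann-decidable R ν p₁≐ann)
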